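{- Let $\Lambda=\Sigma_{+- }$ be the tent map on binary words and $n\ge1$. If $s,t\in\mathcal W_2$ are such that $\mathrm{Pat}(s,\Lambda,n)$ and $\mathrm{Pat}(t,\Lambda,n)$ are both defined and equal, then the finite words $s_1\cdots s_{n-1}$ and $t_1\cdots t_{n-1}$ differ in at most one position.
   Context: $\mathcal W_2$ is the set of infinite words $s_1s_2\cdots$ over $\{0,1\}$. The order $\prec_\Lambda$ on $\mathcal W_2$: for $s\ne t$, with $j$ minimal such that $s_j\ne t_j$ and $c$ the number of indices $1\le i<j$ with $s_i=1$, $s\prec_\Lambda t$ iff ($c$ even and $s_j<t_j$) or ($c$ odd and $s_j>t_j$). The tent map is $\Lambda(s_1s_2\cdots)=s_2s_3\cdots$ on $(\mathcal W_2,\prec_\Lambda)$. $\mathrm{Pat}(s,\Lambda,n)$ is the permutation of $[n]$ (one-line notation) in the same relative order, under $\prec_\Lambda$, as $s,\Lambda(s),\dots,\Lambda^{n-1}(s)$, defined only when these $n$ words are pairwise distinct. -}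

module Defs where

open import Data.Bool using (Bool; true; false)
open import Data.Nat using (ℕ; zero; suc; _+_; _<_; _%_)
open import Data.Fin using (Fin; toℕ)
open import Data.Fin.Permutation using (Permutation′; _⟨$⟩ʳ_)
open import Data.Product using (Σ; _×_; ∃)
open import Data.Sum using (_⊎_)
open import Relation.Nullary using (¬_)
open import Relation.Binary.PropositionalEquality using (_≡_)
open import Function.Bundles using (_⇔_)

-- Infinite binary words s₁s₂⋯ , 0-indexed: s i is the letter s_{i+1}.
W₂ : Set
W₂ = ℕ → Bool

ones : W₂ → ℕ → ℕ
ones s zero = zero
ones s (suc j) with s j
... | true  = suc (ones s j)
... | false = ones s j

_≺Λ_ : W₂ → W₂ → Set
s ≺Λ t = ∃ λ j → (∀ i → i < j → s i ≡ t i) ×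
  (  (ones s j % 2 ≡ 0 × s j ≡ false × t j ≡ true)
   ⊎ (ones s j % 2 ≡ 1 × s j ≡ true × t j ≡ false))

_≢W_ : W₂ → W₂ → Set
s ≢W t = ¬ (∀ i → s i ≡ t i)

Λ : W₂ → W₂
Λ s i = s (suc i)

Λ^ : ℕ → W₂ → W₂
Λ^ k s i = s (k + i)

-- PatIs s n π : Pat(s,Λ,n) is defined and equals π, i.e. the words
-- s, Λ s, …, Λ^{n-1} s are pairwise distinct and π (0-indexed one-line
-- notation) is in the same relative order as them under ≺Λ.
PatIs : W₂ → (n : ℕ) → Permutation′ n → Set
PatIs s n π =
  (∀ (i j : Fin n) → ¬ (i ≡ j) → Λ^ (toℕ i) s ≢W Λ^ (toℕ j) s) ×
  (∀ (i j : Fin n) → (toℕ (π ⟨$⟩ʳ i) < toℕ (π ⟨$⟩ʳ j)) ⇔ (Λ^ (toℕ i) s ≺Λ Λ^ (toℕ j) s))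

module Submission where

-- Let s and t realise the same pattern π of length n, and
-- suppose two distinct positions i, j < n - 1 had s_i ≠ t_i and s_j ≠ t_j.
-- Since π ranks the iterates Λ^k s (k < n) exactly as it ranks the Λ^k t,
-- the relative order of Λ^i and Λ^j, and of Λ^(i+1) and Λ^(j+1), is the
-- same for both words.  Two cases, both contradictory:
--  * crossed letters (s_i = t_j ≠ s_j = t_i): the first letters already
--    order Λ^i s, Λ^j s one way and Λ^i t, Λ^j t the other way;
--  * parallel letters (s_i = s_j ≠ t_i = t_j): deleting a common leading 0
--    preserves ≺Λ while deleting a common leading 1 reverses it, so the
--    order of Λ^(i+1), Λ^(j+1) agrees with that of Λ^i, Λ^j for one word
--    and is reversed for the other.

open import Defs
open import Data.Bool using (Bool; true; false; not)
open import Data.Bool.Properties using (¬-not) renaming (_≟_ to _≟ᴮ_)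
open import Data.Nat using (ℕ; zero; suc; _%_; _≤_; _<_; _∸_; s≤s)
open import Data.Nat.Properties
  using (+-identityʳ; +-suc; ≤-refl; <⇒≤; m<n⇒m<1+n; <-asym; <-cmp; anyUpTo?)
open import Data.Nat.DivMod using (%-pred-≡0)
open import Data.Fin using (toℕ; fromℕ<)
open import Data.Fin.Properties using (toℕ-fromℕ<; toℕ-injective; fromℕ<-injective)
open import Data.Fin.Permutation using (Permutation′; _⟨$⟩ʳ_; _⟨$⟩ˡ_; inverseˡ)
open import Data.Product using (∃; _×_; _,_)
open import Data.Sum using (_⊎_; inj₁; inj₂)
open import Data.Empty using (⊥; ⊥-elim)
open import Function using (_∘_)
open import Function.Bundles using (_⇔_; Equivalence)
open import Relation.Nullary using (¬_; ¬?; yes; no)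
open import Relation.Nullary.Decidable using (decidable-stable)
open import Relation.Binary using (tri<; tri≈; tri>)
open import Relation.Binary.PropositionalEquality
  using (_≡_; refl; sym; trans; cong; subst; subst₂; module ≡-Reasoning)

Decisive : ℕ → Bool → Bool → Set
Decisive c a b = (c % 2 ≡ 0 × a ≡ false × b ≡ true) ⊎ (c % 2 ≡ 1 × a ≡ true × b ≡ false)

decisive-differ : ∀ {c a b} → Decisive c a b → ¬ a ≡ b
decisive-differ (inj₁ (_ , refl , refl)) ()
decisive-differ (inj₂ (_ , refl , refl)) ()

odd-pred : ∀ m → suc m % 2 ≡ 1 → m % 2 ≡ 0
odd-pred zero          _ = refl
odd-pred (suc zero)    ()
odd-pred (suc (suc m)) e = odd-pred m e

decisive-flip : ∀ {c a b} → Decisive (suc c) a b → Decisive c b a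
decisive-flip {c} (inj₁ (even , a , b)) = inj₂ (%-pred-≡0 {c} even , b , a)
decisive-flip {c} (inj₂ (odd , a , b))  = inj₁ (odd-pred c odd , b , a)

ones-prefix : ∀ (u v : W₂) j → (∀ i → i < j → u i ≡ v i) → ones u j ≡ ones v j
ones-prefix u v zero    _     = refl
ones-prefix u v (suc j) agree with u j | v j | agree j ≤-refl
... | true  | .true  | refl = cong suc (ones-prefix u v j (λ i i<j → agree i (m<n⇒m<1+n i<j)))
... | false | .false | refl = ones-prefix u v j (λ i i<j → agree i (m<n⇒m<1+n i<j))

ones-tail-0 : ∀ (u : W₂) → u 0 ≡ false → ∀ k → ones u (suc k) ≡ ones (Λ u) k
ones-tail-0 u u₀ zero rewrite u₀ = refl
ones-tail-0 u u₀ (suc k) with u (suc k)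
... | true  = cong suc (ones-tail-0 u u₀ k)
... | false = ones-tail-0 u u₀ k

ones-tail-1 : ∀ (u : W₂) → u 0 ≡ true → ∀ k → ones u (suc k) ≡ suc (ones (Λ u) k)
ones-tail-1 u u₀ zero rewrite u₀ = refl
ones-tail-1 u u₀ (suc k) with u (suc k)
... | true  = cong suc (ones-tail-1 u u₀ k)
... | false = ones-tail-1 u u₀ k

≺Λ-resp : ∀ {u u′ v v′ : W₂} → (∀ x → u x ≡ u′ x) → (∀ x → v x ≡ v′ x) →
  u ≺Λ v → u′ ≺Λ v′
≺Λ-resp {u} {u′} {v} {v′} eu ev (j , agree , d) =
  j , (λ i i<j → trans (sym (eu i)) (trans (agree i i<j) (ev i))) ,
  subst₂ (λ c a → Decisive c a (v′ j)) (ones-prefix u u′ j (λ i _ → eu i)) (eu j)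
    (subst (Decisive (ones u j) (u j)) (ev j) d)

≺Λ-head : ∀ {u v : W₂} → u 0 ≡ false → v 0 ≡ true → u ≺Λ v
≺Λ-head u₀ v₀ = 0 , (λ _ ()) , inj₁ (refl , u₀ , v₀)

≺Λ-tail-0 : ∀ {u v : W₂} → u 0 ≡ false → v 0 ≡ false → u ≺Λ v → Λ u ≺Λ Λ v
≺Λ-tail-0 u₀ v₀ (zero , _ , d) = ⊥-elim (decisive-differ {0} d (trans u₀ (sym v₀)))
≺Λ-tail-0 {u} {v} u₀ v₀ (suc k , agree , d) =
  k , (λ i i<k → agree (suc i) (s≤s i<k)) ,
  subst (λ c → Decisive c (u (suc k)) (v (suc k))) (ones-tail-0 u u₀ k) d

≺Λ-tail-1 : ∀ {u v : W₂} → u 0 ≡ true → v 0 ≡ true → u ≺Λ v → Λ v ≺Λ Λ u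
≺Λ-tail-1 u₀ v₀ (zero , _ , d) = ⊥-elim (decisive-differ {0} d (trans u₀ (sym v₀)))
≺Λ-tail-1 {u} {v} u₀ v₀ (suc k , agree , d) =
  k , (λ i i<k → sym (agree (suc i) (s≤s i<k))) ,
  subst (λ c → Decisive c (v (suc k)) (u (suc k))) same-ones
    (decisive-flip {ones (Λ u) k}
      (subst (λ c → Decisive c (u (suc k)) (v (suc k))) (ones-tail-1 u u₀ k) d))
  where
  same-ones : ones (Λ u) k ≡ ones (Λ v) k
  same-ones = ones-prefix (Λ u) (Λ v) k (λ i i<k → agree (suc i) (s≤s i<k))

Λ^-head : ∀ (s : W₂) i → Λ^ i s 0 ≡ s i
Λ^-head s i = cong s (+-identityʳ i)

Λ-Λ^ : ∀ (s : W₂) i x → Λ (Λ^ i s) x ≡ Λ^ (suc i) s x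
Λ-Λ^ s i x = cong s (+-suc i x)

orbit-head : ∀ (s : W₂) {i j} → s i ≡ false → s j ≡ true → Λ^ i s ≺Λ Λ^ j s
orbit-head s {i} {j} sᵢ sⱼ = ≺Λ-head (trans (Λ^-head s i) sᵢ) (trans (Λ^-head s j) sⱼ)

orbit-step-0 : ∀ (s : W₂) {i j} → s i ≡ false → s j ≡ false →
  Λ^ i s ≺Λ Λ^ j s → Λ^ (suc i) s ≺Λ Λ^ (suc j) s
orbit-step-0 s {i} {j} sᵢ sⱼ lt = ≺Λ-resp (Λ-Λ^ s i) (Λ-Λ^ s j)
  (≺Λ-tail-0 (trans (Λ^-head s i) sᵢ) (trans (Λ^-head s j) sⱼ) lt)

orbit-step-1 : ∀ (s : W₂) {i j} → s i ≡ true → s j ≡ true →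
  Λ^ i s ≺Λ Λ^ j s → Λ^ (suc j) s ≺Λ Λ^ (suc i) s
orbit-step-1 s {i} {j} sᵢ sⱼ lt = ≺Λ-resp (Λ-Λ^ s j) (Λ-Λ^ s i)
  (≺Λ-tail-1 (trans (Λ^-head s i) sᵢ) (trans (Λ^-head s j) sⱼ) lt)

module _ (n : ℕ) (π : Permutation′ n) where

  rank : ∀ i → i < n → ℕ
  rank i i<n = toℕ (π ⟨$⟩ʳ fromℕ< i<n)

  rank-injective : ∀ {i j} (i<n : i < n) (j<n : j < n) → rank i i<n ≡ rank j j<n → i ≡ j
  rank-injective {i} {j} i<n j<n eq = fromℕ<-injective i j i<n j<n (begin
      fromℕ< i<n                          ≡⟨ sym (inverseˡ π) ⟩
      π ⟨$⟩ˡ (π ⟨$⟩ʳ fromℕ< i<n)          ≡⟨ cong (π ⟨$⟩ˡ_) (toℕ-injective eq) ⟩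
      π ⟨$⟩ˡ (π ⟨$⟩ʳ fromℕ< j<n)          ≡⟨ inverseˡ π ⟩
      fromℕ< j<n                          ∎)
    where open ≡-Reasoning

  pattern-order : ∀ s {i j} → PatIs s n π → (i<n : i < n) (j<n : j < n) →
    rank i i<n < rank j j<n ⇔ Λ^ i s ≺Λ Λ^ j s
  pattern-order s (_ , order) i<n j<n =
    subst₂ (λ a b → rank _ i<n < rank _ j<n ⇔ Λ^ a s ≺Λ Λ^ b s)
      (toℕ-fromℕ< i<n) (toℕ-fromℕ< j<n) (order (fromℕ< i<n) (fromℕ< j<n))

  crossed-letters : ∀ {u w i j} → PatIs u n π → PatIs w n π → (i<n : i < n) (j<n : j < n) →
    u i ≡ false → u j ≡ true → w i ≡ true → w j ≡ false → ⊥
  crossed-letters {u} {w} Pu Pw i<n j<n uᵢ uⱼ wᵢ wⱼ = <-asym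
    (Equivalence.from (pattern-order u Pu i<n j<n) (orbit-head u uᵢ uⱼ))
    (Equivalence.from (pattern-order w Pw j<n i<n) (orbit-head w wⱼ wᵢ))

  -- Parallel letters with rank i < rank j: u_i = u_j = 0 and w_i = w_j = 1
  -- force rank (i+1) < rank (j+1) via u and the reverse via w.
  parallel-ordered : ∀ {u w i j} → PatIs u n π → PatIs w n π →
    (i+1<n : suc i < n) (j+1<n : suc j < n) →
    u i ≡ false → u j ≡ false → w i ≡ true → w j ≡ true →
    rank i (<⇒≤ i+1<n) < rank j (<⇒≤ j+1<n) → ⊥
  parallel-ordered {u} {w} Pu Pw i+1<n j+1<n uᵢ uⱼ wᵢ wⱼ lt = <-asym
    (Equivalence.from (pattern-order u Pu i+1<n j+1<n)
      (orbit-step-0 u uᵢ uⱼ (Equivalence.to (pattern-order u Pu i<n j<n) lt)))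
    (Equivalence.from (pattern-order w Pw j+1<n i+1<n)
      (orbit-step-1 w wᵢ wⱼ (Equivalence.to (pattern-order w Pw i<n j<n) lt)))
    where
    i<n = <⇒≤ i+1<n
    j<n = <⇒≤ j+1<n

  parallel-letters : ∀ {u w i j} → PatIs u n π → PatIs w n π → ¬ i ≡ j →
    (i+1<n : suc i < n) (j+1<n : suc j < n) →
    u i ≡ false → u j ≡ false → w i ≡ true → w j ≡ true → ⊥
  parallel-letters Pu Pw i≢j i+1<n j+1<n uᵢ uⱼ wᵢ wⱼ
    with <-cmp (rank _ (<⇒≤ i+1<n)) (rank _ (<⇒≤ j+1<n))
  ... | tri< lt _ _ = parallel-ordered Pu Pw i+1<n j+1<n uᵢ uⱼ wᵢ wⱼ lt
  ... | tri≈ _ eq _ = i≢j (rank-injective (<⇒≤ i+1<n) (<⇒≤ j+1<n) eq)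
  ... | tri> _ _ gt = parallel-ordered Pu Pw j+1<n i+1<n uⱼ uᵢ wⱼ wᵢ gt

  no-two-differences : ∀ {s t i j} → PatIs s n π → PatIs t n π → ¬ i ≡ j →
    suc i < n → suc j < n → ¬ s i ≡ t i → ¬ s j ≡ t j → ⊥
  no-two-differences {s} {t} {i} {j} Ps Pt i≢j i+1<n j+1<n sᵢ≢tᵢ sⱼ≢tⱼ =
    by-letters (s i) (s j) refl refl (¬-not (sᵢ≢tᵢ ∘ sym)) (¬-not (sⱼ≢tⱼ ∘ sym))
    where
    i<n = <⇒≤ i+1<n
    j<n = <⇒≤ j+1<n
    by-letters : ∀ a b → s i ≡ a → s j ≡ b → t i ≡ not a → t j ≡ not b → ⊥
    by-letters false false sᵢ sⱼ tᵢ tⱼ = parallel-letters Ps Pt i≢j i+1<n j+1<n sᵢ sⱼ tᵢ tⱼ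
    by-letters true  true  sᵢ sⱼ tᵢ tⱼ = parallel-letters Pt Ps i≢j i+1<n j+1<n tᵢ tⱼ sᵢ sⱼ
    by-letters false true  sᵢ sⱼ tᵢ tⱼ = crossed-letters Ps Pt i<n j<n sᵢ sⱼ tᵢ tⱼ
    by-letters true  false sᵢ sⱼ tᵢ tⱼ = crossed-letters Ps Pt j<n i<n sⱼ sᵢ tⱼ tᵢ

-- Either s and t agree below n - 1, and any p works, or they differ at some
-- p < n - 1, which is then the only difference.
lemma3p2 : (n : ℕ) → 1 ≤ n → (s t : W₂) → (π : Permutation′ n) →
    PatIs s n π → PatIs t n π →
    ∃ λ p → ∀ i → i < n ∸ 1 → ¬ (i ≡ p) → s i ≡ t i
lemma3p2 (suc m) _ s t π Ps Pt with anyUpTo? (λ k → ¬? (s k ≟ᴮ t k)) m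
... | yes (p , p<m , sₚ≢tₚ) = p , λ i i<m i≢p → decidable-stable (s i ≟ᴮ t i) λ sᵢ≢tᵢ →
  no-two-differences (suc m) π Ps Pt i≢p (s≤s i<m) (s≤s p<m) sᵢ≢tᵢ sₚ≢tₚ
... | no no-difference = 0 , λ i i<m _ → decidable-stable (s i ≟ᴮ t i) λ sᵢ≢tᵢ →
  no-difference (i , i<m , sᵢ≢tᵢ)
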